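{- Computing the optimal objective value of the nonlinear matroid optimization problem in variable dimension $d=n$, over any matroid $M$ on $N=\{1,\dots,n\}$, with $\{0,1\}$-valued weights $w_i=\mathbf{1}_i$ (the $i$-th standard unit vector in $\mathbb{R}^n$) for $i=1,\dots,n$, and with $f:\mathbb{R}^n\to\mathbb{R}$ presented by a comparison oracle, requires examining $f(W(B))$ for each of the $|\mathcal{B}(M)|$ bases $B$ of $M$. In particular, for each $r$ with $1\le r\le k$, the problem cannot be solved in polynomial time for the class of matroids $\mathcal{M}_{r,k}$.
   Context: $W(B)=(w_1(B),\dots,w_d(B))$ with $w_i(B)=\sum_{j\in B}w_{i,j}$; $\mathcal{B}(M)$ is the set of bases of $M$. A comparison oracle for $f$ answers queries "is $f(x)\le f(y)$?". The class $\mathcal{M}_{r,k}$: for $1\le r\le k$, partition $K=\{1,\dots,k\}$ into $r$ parts $K_1,\dots,K_r$, let $\bar K_i=\{\bar j: j\in K_i\}$ be disjoint copies, let $\mathcal{M}_i$ be the uniform matroid of rank $|K_i|$ on $K_i\cup\bar K_i$, and let $\mathcal{M}_{r,k}=\bigoplus_{i=1}^r\mathcal{M}_i$ (direct sum), a matroid on $2k$ elements.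
   Formalization: The function f maps ℚ^n to ℚ rather than ℝ^n to ℝ, and the algorithms, taken as comparison decision trees, compare and output only points with rational coordinates. -}

module Defs where

open import Data.Nat using (ℕ; zero; suc)
open import Data.Fin using (Fin; splitAt)
open import Data.Fin.Properties using () renaming (_≟_ to _≟ᶠ_)
open import Data.Fin.Subset using (Subset; inside; outside; _∈_; _∉_; _∩_; ∣_∣)
open import Data.Vec using (Vec; []; _∷_; tabulate; _[_]≔_)
open import Data.List using (List; []; _∷_; length)
open import Data.List.Relation.Unary.Any using (Any)
open import Data.Rational using (ℚ; 0ℚ; 1ℚ; _+_; _≤_)
import Data.Nat
import Data.Fin
import Data.Bool
open import Data.Rational.Properties using (_≤?_)
open import Data.Product using (Σ; ∃; _×_; _,_)
open import Data.Sum using (_⊎_; [_,_])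
open import Data.Bool using (if_then_else_)
open import Function using (id)
open import Relation.Nullary.Decidable using (does)
open import Relation.Binary.PropositionalEquality using (_≡_)

record Matroid (n : ℕ) : Set₁ where
  field
    IsBasis  : Subset n → Set
    nonempty : ∃ λ B → IsBasis B
    exchange : ∀ B₁ B₂ → IsBasis B₁ → IsBasis B₂ →
               ∀ x → x ∈ B₁ → x ∉ B₂ →
               ∃ λ y → y ∈ B₂ × y ∉ B₁ ×
                        IsBasis ((B₁ [ x ]≔ outside) [ y ]≔ inside)

∑ : ∀ {n} → (Fin n → ℚ) → ℚ
∑ {zero}  f = 0ℚ
∑ {suc n} f = f Fin.zero Data.Rational.+ ∑ (λ j → f (Fin.suc j))

W : ∀ {d n} → (Fin d → Fin n → ℚ) → Subset n → Vec ℚ d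
W {d} {n} w B = tabulate λ i → ∑ λ j → sel (Data.Vec.lookup B j) (w i j)
  where
  sel : Data.Bool.Bool → ℚ → ℚ
  sel b q = if b then q else 0ℚ

unitWeights : ∀ {n} → Fin n → Fin n → ℚ
unitWeights i j = if does (i ≟ᶠ j) then 1ℚ else 0ℚ

-- Algorithms in the comparison-oracle model: deterministic decision
-- trees. A node asks "is f(x) ≤ f(y)?" and branches on the answer; a
-- leaf outputs a point x ∈ ℚ^d, claiming f(x) is the optimal value.

data Tree (d : ℕ) : Set where
  leaf  : Vec ℚ d → Tree d
  query : (x y : Vec ℚ d) → (yes no : Tree d) → Tree d

Oracle : ℕ → Set
Oracle d = Vec ℚ d → ℚ

output : ∀ {d} → Tree d → Oracle d → Vec ℚ d
output (leaf x)          f = x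
output (query x y t₁ t₂) f =
  if does (f x ≤? f y) then output t₁ f else output t₂ f

examined : ∀ {d} → Tree d → Oracle d → List (Vec ℚ d)
examined (leaf x)          f = []
examined (query x y t₁ t₂) f =
  x ∷ y ∷ (if does (f x ≤? f y) then examined t₁ f else examined t₂ f)

queries : ∀ {d} → Tree d → Oracle d → ℕ
queries (leaf x)          f = 0
queries (query x y t₁ t₂) f =
  suc (if does (f x ≤? f y) then queries t₁ f else queries t₂ f)

IsOptValue : ∀ {d n} → (Subset n → Set) → (Fin d → Fin n → ℚ) →
             Oracle d → ℚ → Set
IsOptValue IsBasis w f v =
  (∃ λ B → IsBasis B × f (W w B) ≡ v) ×
  (∀ B → IsBasis B → f (W w B) ≤ v)

Computes : ∀ {d n} → (Subset n → Set) → (Fin d → Fin n → ℚ) → Tree d → Set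
Computes IsBasis w T = ∀ f → IsOptValue IsBasis w f (f (output T f))

Examines : ∀ {d n} → (Fin d → Fin n → ℚ) → Tree d → Oracle d → Subset n → Set
Examines w T f B = Any (λ x → W w B ≡ x) (examined T f) ⊎ W w B ≡ output T f

-- A partition of K = Fin k into r (nonempty) parts
-- is a surjection part : Fin k → Fin r (K_i = part⁻¹(i)).  The ground
-- set K ∪ K̄ is Fin (k + k): e < k is j = e, e ≥ k is the copy j̄.
-- 𝓜_{r,k} = ⊕ᵢ U(|K_i|, K_i ∪ K̄_i); its bases are exactly the sets B
-- with |B ∩ (K_i ∪ K̄_i)| = |K_i| for every i.

IsPartition : ∀ {k r} → (Fin k → Fin r) → Set
IsPartition {k} {r} part = ∀ i → ∃ λ j → part j ≡ i

block : ∀ {k r} → (Fin k → Fin r) → Fin r → Subset (k Data.Nat.+ k)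
block {k} part i = tabulate λ e →
  if does (part ([ id , id ] (splitAt k e)) ≟ᶠ i) then inside else outside

Kpart : ∀ {k r} → (Fin k → Fin r) → Fin r → Subset k
Kpart part i = tabulate λ j → if does (part j ≟ᶠ i) then inside else outside

IsBasis-Mrk : ∀ {k r} → (Fin k → Fin r) → Subset (k Data.Nat.+ k) → Set
IsBasis-Mrk part B = ∀ i → ∣ B ∩ block part i ∣ ≡ ∣ Kpart part i ∣

-- Adversary argument.  Run a tree that computes the optimum against the
-- constant oracle 0.  If some basis B had W(B) neither compared nor output,
-- the indicator oracle of the point W(B) would answer every comparison of
-- that run the same way, so the tree would output the same point, of value
-- 0, although the optimum is f(W(B)) = 1.  Hence the run examines W(B) for
-- every basis B.  With unit weights W is injective on subsets, and 𝓜_{r,k}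
-- has the 2^k bases S ∪ (K∖S)‾, so the run makes at least (2^k - 1)/2
-- comparisons, which eventually beats every polynomial c·k^c.
module Submission where

open import Defs
open import Data.Nat using (ℕ; _*_; _^_; _≤_; _<_)
open import Data.Fin using (Fin)
open import Data.Product using (∃; _×_)

open import Data.Nat.Base using (zero; suc; _+_; _∸_; z≤n; s≤s; s≤s⁻¹; >-nonZero)
open import Data.Nat.Properties
open import Algebra.Properties.CommutativeSemigroup *-commutativeSemigroup
  using (xy∙z≈y∙xz; xy∙z≈x∙zy; x∙yz≈y∙xz; x∙yz≈xz∙y)
open import Data.Fin.Base as Fin using (splitAt; finToFun; funToFin)
open import Data.Fin.Properties using (2↔Bool; funToFin-finToFin; injective⇒≤)
  renaming (_≟_ to _≟ᶠ_)
open import Data.Fin.Subset using (Subset; inside; outside; ∁; _∩_; ∣_∣)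
open import Data.Vec.Base using (Vec; []; _∷_; _++_; tabulate; lookup)
open import Data.Vec.Properties
  using (≡-dec; lookup∘tabulate; tabulate∘lookup; tabulate-cong; zipWith-++; ++-injectiveˡ)
open import Data.List.Base as List using (List; length)
open import Data.List.Relation.Unary.Any as Any using (here; there)
open import Data.List.Relation.Unary.Any.Properties using (lookup-index)
open import Data.List.Relation.Unary.All as All using (All; _∷_)
open import Data.List.Relation.Unary.All.Properties using (¬Any⇒All¬)
open import Data.List.Membership.Propositional using (_∈_)
open import Data.Rational.Base as ℚ using (ℚ; 0ℚ; 1ℚ; *≤*)
import Data.Rational.Properties as ℚₚ
open import Data.Integer.Base using (+≤+)
open import Data.Bool.Base using (Bool; true; false; if_then_else_)
open import Data.Product using (_,_; proj₂)
open import Data.Sum.Base using (_⊎_; inj₁; inj₂; [_,_]; map₁)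
open import Function.Base using (id; _∘_; const)
open import Function.Bundles using (Inverse; Injection)
open import Function.Properties.Inverse using (↔⇒↣)
open import Function.Definitions using (Injective)
open import Relation.Nullary using (¬_; yes; no; does)
open import Relation.Nullary.Negation using (contradiction)
open import Relation.Binary.PropositionalEquality hiding ([_])

output-agree : ∀ {d} (T : Tree d) (f g : Oracle d) →
               All (λ x → g x ≡ f x) (examined T f) → output T g ≡ output T f
output-agree (leaf x)          f g _ = refl
output-agree (query x y t₁ t₂) f g (gx≡fx ∷ gy≡fy ∷ agree)
  rewrite gx≡fx | gy≡fy with does (f x ℚₚ.≤? f y)
... | true  = output-agree t₁ f g agree
... | false = output-agree t₂ f g agree

length-examined : ∀ {d} (T : Tree d) (f : Oracle d) →
                  length (examined T f) ≡ 2 * queries T f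
length-examined (leaf x)          f = refl
length-examined (query x y t₁ t₂) f with does (f x ℚₚ.≤? f y)
... | true  = trans (cong (suc ∘ suc) (length-examined t₁ f)) (sym (*-suc 2 (queries t₁ f)))
... | false = trans (cong (suc ∘ suc) (length-examined t₂ f)) (sym (*-suc 2 (queries t₂ f)))

zeroOracle : ∀ {d} → Oracle d
zeroOracle = const 0ℚ

indicator : ∀ {d} → Vec ℚ d → Oracle d
indicator x y = if does (≡-dec ℚₚ._≟_ x y) then 1ℚ else 0ℚ

indicator-self : ∀ {d} (x : Vec ℚ d) → indicator x x ≡ 1ℚ
indicator-self x with ≡-dec ℚₚ._≟_ x x
... | yes _   = refl
... | no x≢x = contradiction refl x≢x

indicator-other : ∀ {d} {x y : Vec ℚ d} → x ≢ y → indicator x y ≡ 0ℚ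
indicator-other {x = x} {y} x≢y with ≡-dec ℚₚ._≟_ x y
... | yes x≡y = contradiction x≡y x≢y
... | no _    = refl

1ℚ≰0ℚ : ¬ (1ℚ ℚ.≤ 0ℚ)
1ℚ≰0ℚ (*≤* (+≤+ ()))

examines-every-basis : ∀ {d n} (IsBasis : Subset n → Set) (w : Fin d → Fin n → ℚ) (T : Tree d) →
                       Computes IsBasis w T → ∀ B → IsBasis B → Examines w T zeroOracle B
examines-every-basis IsBasis w T computes B isBasis
  with Any.any? (≡-dec ℚₚ._≟_ (W w B)) (examined T zeroOracle)
     | ≡-dec ℚₚ._≟_ (W w B) (output T zeroOracle)
... | yes compared | _          = inj₁ compared
... | no _         | yes output = inj₂ output
... | no ¬compared | no ¬output = contradiction 1≤0 1ℚ≰0ℚ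
  where
  g = indicator (W w B)
  same-output : output T g ≡ output T zeroOracle
  same-output = output-agree T zeroOracle g
    (All.map indicator-other (¬Any⇒All¬ (examined T zeroOracle) ¬compared))
  1≤0 : 1ℚ ℚ.≤ 0ℚ
  1≤0 = subst₂ ℚ._≤_ (indicator-self (W w B))
          (trans (cong g same-output) (indicator-other ¬output))
          (proj₂ (computes g) B isBasis)

fromBool : Bool → ℚ
fromBool b = if b then 1ℚ else 0ℚ

fromBool-injective : Injective _≡_ _≡_ fromBool
fromBool-injective {true}  {true}  _ = refl
fromBool-injective {false} {false} _ = refl

∑-zero : ∀ {n} (f : Fin n → ℚ) → (∀ j → f j ≡ 0ℚ) → ∑ f ≡ 0ℚ
∑-zero {zero}  f f≡0 = refl
∑-zero {suc n} f f≡0 =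
  trans (cong₂ ℚ._+_ (f≡0 Fin.zero) (∑-zero (f ∘ Fin.suc) (f≡0 ∘ Fin.suc))) (ℚₚ.+-identityˡ 0ℚ)

if-0ℚ : ∀ b → (if b then 0ℚ else 0ℚ) ≡ 0ℚ
if-0ℚ true  = refl
if-0ℚ false = refl

∑-select-unit : ∀ {n} (B : Fin n → Bool) (i : Fin n) →
                ∑ (λ j → if B j then unitWeights i j else 0ℚ) ≡ fromBool (B i)
∑-select-unit {suc n} B Fin.zero =
  trans (cong (fromBool (B Fin.zero) ℚ.+_) (∑-zero _ (if-0ℚ ∘ B ∘ Fin.suc)))
        (ℚₚ.+-identityʳ _)
∑-select-unit {suc n} B (Fin.suc i) =
  trans (cong₂ ℚ._+_ (if-0ℚ (B Fin.zero)) (∑-select-unit (B ∘ Fin.suc) i))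
        (ℚₚ.+-identityˡ _)

lookup-W-unitWeights : ∀ {n} (B : Subset n) i → lookup (W unitWeights B) i ≡ fromBool (lookup B i)
lookup-W-unitWeights B i = trans (lookup∘tabulate _ i) (∑-select-unit (lookup B) i)

W-unitWeights-injective : ∀ {n} → Injective _≡_ _≡_ (W {n} unitWeights)
W-unitWeights-injective {x = B} {C} WB≡WC = begin
  B                      ≡⟨ tabulate∘lookup B ⟨
  tabulate (lookup B)    ≡⟨ tabulate-cong lookup-≡ ⟩
  tabulate (lookup C)    ≡⟨ tabulate∘lookup C ⟩
  C                      ∎
  where
  open ≡-Reasoning
  lookup-≡ : ∀ i → lookup B i ≡ lookup C i
  lookup-≡ i = fromBool-injective (begin
    fromBool (lookup B i)            ≡⟨ lookup-W-unitWeights B i ⟨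
    lookup (W unitWeights B) i       ≡⟨ cong (λ v → lookup v i) WB≡WC ⟩
    lookup (W unitWeights C) i       ≡⟨ lookup-W-unitWeights C i ⟩
    fromBool (lookup C i)            ∎)

copyComplement : ∀ {k} → Subset k → Subset (k + k)
copyComplement S = S ++ ∁ S

tabulate-splitAt : ∀ m {n} {A : Set} (h : Fin m ⊎ Fin n → A) →
                   tabulate (h ∘ splitAt m) ≡ tabulate (h ∘ inj₁) ++ tabulate (h ∘ inj₂)
tabulate-splitAt zero    h = refl
tabulate-splitAt (suc m) h =
  cong (h (inj₁ Fin.zero) ∷_) (tabulate-splitAt m (h ∘ map₁ Fin.suc))

block≡Kpart++Kpart : ∀ {k r} (part : Fin k → Fin r) i → block part i ≡ Kpart part i ++ Kpart part i
block≡Kpart++Kpart {k} part i =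
  tabulate-splitAt k (λ s → if does (part ([ id , id ] s) ≟ᶠ i) then inside else outside)

∣p++q∣≡∣p∣+∣q∣ : ∀ {m n} (p : Subset m) (q : Subset n) → ∣ p ++ q ∣ ≡ ∣ p ∣ + ∣ q ∣
∣p++q∣≡∣p∣+∣q∣ []            q = refl
∣p++q∣≡∣p∣+∣q∣ (inside  ∷ p) q = cong suc (∣p++q∣≡∣p∣+∣q∣ p q)
∣p++q∣≡∣p∣+∣q∣ (outside ∷ p) q = ∣p++q∣≡∣p∣+∣q∣ p q

∣p∩q∣+∣∁p∩q∣≡∣q∣ : ∀ {n} (p q : Subset n) → ∣ p ∩ q ∣ + ∣ ∁ p ∩ q ∣ ≡ ∣ q ∣
∣p∩q∣+∣∁p∩q∣≡∣q∣ []            []            = refl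
∣p∩q∣+∣∁p∩q∣≡∣q∣ (inside  ∷ p) (inside  ∷ q) = cong suc (∣p∩q∣+∣∁p∩q∣≡∣q∣ p q)
∣p∩q∣+∣∁p∩q∣≡∣q∣ (outside ∷ p) (inside  ∷ q) = trans (+-suc _ _) (cong suc (∣p∩q∣+∣∁p∩q∣≡∣q∣ p q))
∣p∩q∣+∣∁p∩q∣≡∣q∣ (inside  ∷ p) (outside ∷ q) = ∣p∩q∣+∣∁p∩q∣≡∣q∣ p q
∣p∩q∣+∣∁p∩q∣≡∣q∣ (outside ∷ p) (outside ∷ q) = ∣p∩q∣+∣∁p∩q∣≡∣q∣ p q

copyComplement-isBasis : ∀ {k r} (part : Fin k → Fin r) (S : Subset k) →
                         IsBasis-Mrk part (copyComplement S)
copyComplement-isBasis part S i = begin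
  ∣ (S ++ ∁ S) ∩ block part i ∣            ≡⟨ cong (λ b → ∣ (S ++ ∁ S) ∩ b ∣) (block≡Kpart++Kpart part i) ⟩
  ∣ (S ++ ∁ S) ∩ (K ++ K) ∣                ≡⟨ cong ∣_∣ (zipWith-++ _ S (∁ S) K K) ⟩
  ∣ (S ∩ K) ++ (∁ S ∩ K) ∣                 ≡⟨ ∣p++q∣≡∣p∣+∣q∣ (S ∩ K) (∁ S ∩ K) ⟩
  ∣ S ∩ K ∣ + ∣ ∁ S ∩ K ∣                  ≡⟨ ∣p∩q∣+∣∁p∩q∣≡∣q∣ S K ⟩
  ∣ K ∣                                    ∎
  where
  open ≡-Reasoning
  K = Kpart part i

subsetOf : ∀ k → Fin (2 ^ k) → Subset k
subsetOf k i = tabulate (Inverse.to 2↔Bool ∘ finToFun i)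

funToFin-cong : ∀ {m n} {f g : Fin m → Fin n} → (∀ i → f i ≡ g i) → funToFin f ≡ funToFin g
funToFin-cong {zero}  f≗g = refl
funToFin-cong {suc m} f≗g = cong₂ Fin.combine (f≗g Fin.zero) (funToFin-cong (f≗g ∘ Fin.suc))

subsetOf-injective : ∀ k → Injective _≡_ _≡_ (subsetOf k)
subsetOf-injective k {i} {j} Si≡Sj = begin
  i                             ≡⟨ funToFin-finToFin {k} i ⟨
  funToFin (finToFun {2} {k} i) ≡⟨ funToFin-cong finToFun-≡ ⟩
  funToFin (finToFun {2} {k} j) ≡⟨ funToFin-finToFin {k} j ⟩
  j                             ∎
  where
  open ≡-Reasoning
  finToFun-≡ : ∀ x → finToFun {2} {k} i x ≡ finToFun j x
  finToFun-≡ x = Injection.injective (↔⇒↣ 2↔Bool) (begin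
    Inverse.to 2↔Bool (finToFun i x)  ≡⟨ lookup∘tabulate _ x ⟨
    lookup (subsetOf k i) x           ≡⟨ cong (λ S → lookup S x) Si≡Sj ⟩
    lookup (subsetOf k j) x           ≡⟨ lookup∘tabulate _ x ⟩
    Inverse.to 2↔Bool (finToFun j x)  ∎)

injection-into-list⇒≤length : ∀ {N} {A : Set} (xs : List A) (g : Fin N → A) →
                              Injective _≡_ _≡_ g → (∀ i → g i ∈ xs) → N ≤ length xs
injection-into-list⇒≤length xs g g-injective g∈xs =
  injective⇒≤ {f = Any.index ∘ g∈xs} λ {i} {j} same-index → g-injective (begin
    g i                                  ≡⟨ lookup-index (g∈xs i) ⟩
    List.lookup xs (Any.index (g∈xs i))  ≡⟨ cong (List.lookup xs) same-index ⟩
    List.lookup xs (Any.index (g∈xs j))  ≡⟨ lookup-index (g∈xs j) ⟨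
    g j                                  ∎)
  where open ≡-Reasoning

2^k≤1+2*queries : ∀ {k r} (part : Fin k → Fin r) (T : Tree (k + k)) →
                  Computes (IsBasis-Mrk part) unitWeights T →
                  2 ^ k ≤ suc (2 * queries T zeroOracle)
2^k≤1+2*queries {k} part T computes =
  subst (2 ^ k ≤_) (cong suc (length-examined T zeroOracle))
    (injection-into-list⇒≤length (output T zeroOracle List.∷ examined T zeroOracle)
      (W unitWeights ∘ copyComplement ∘ subsetOf k) injective examined-or-output)
  where
  injective : Injective _≡_ _≡_ (W unitWeights ∘ copyComplement ∘ subsetOf k)
  injective = subsetOf-injective k ∘ ++-injectiveˡ _ _ ∘ W-unitWeights-injective {k + k}
  examined-or-output : ∀ i → W unitWeights (copyComplement (subsetOf k i)) ∈
                             output T zeroOracle List.∷ examined T zeroOracle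
  examined-or-output i
    with examines-every-basis (IsBasis-Mrk part) unitWeights T computes
           (copyComplement (subsetOf k i)) (copyComplement-isBasis part (subsetOf k i))
  ... | inj₁ examined = there examined
  ... | inj₂ output   = here output

[1+k]*[k∸1+c]≤k*[k∸c] : ∀ c k → suc k * (k ∸ suc c) ≤ k * (k ∸ c)
[1+k]*[k∸1+c]≤k*[k∸c] c       zero    = z≤n
[1+k]*[k∸1+c]≤k*[k∸c] zero    (suc k) rewrite *-suc k k = n≤1+n _
[1+k]*[k∸1+c]≤k*[k∸c] (suc c) (suc k) =
  +-mono-≤ (∸-monoʳ-≤ k (n≤1+n c)) ([1+k]*[k∸1+c]≤k*[k∸c] c k)

-- (1 + 1/k)^c ≤ k / (k − c) with denominators cleared.
[1+k]^c*[k∸c]≤k*k^c : ∀ c k → suc k ^ c * (k ∸ c) ≤ k * k ^ c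
[1+k]^c*[k∸c]≤k*k^c zero    k = ≤-reflexive (trans (+-identityʳ k) (sym (*-identityʳ k)))
[1+k]^c*[k∸c]≤k*k^c (suc c) k = begin
  (suc k * suc k ^ c) * (k ∸ suc c)  ≡⟨ xy∙z≈y∙xz (suc k) (suc k ^ c) (k ∸ suc c) ⟩
  suc k ^ c * (suc k * (k ∸ suc c))  ≤⟨ *-monoʳ-≤ (suc k ^ c) ([1+k]*[k∸1+c]≤k*[k∸c] c k) ⟩
  suc k ^ c * (k * (k ∸ c))          ≡⟨ x∙yz≈y∙xz (suc k ^ c) k (k ∸ c) ⟩
  k * (suc k ^ c * (k ∸ c))          ≤⟨ *-monoʳ-≤ k ([1+k]^c*[k∸c]≤k*k^c c k) ⟩
  k * (k * k ^ c)                    ∎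
  where open ≤-Reasoning

[1+k]^c≤2*k^c : ∀ c k → 2 * c ≤ k → suc k ^ c ≤ 2 * k ^ c
[1+k]^c≤2*k^c zero    k       _  = s≤s z≤n
[1+k]^c≤2*k^c (suc c) zero    ()
[1+k]^c≤2*k^c c       k@(suc _) 2c≤k = *-cancelˡ-≤ k (begin
  k * suc k ^ c              ≤⟨ *-monoˡ-≤ (suc k ^ c) k≤2*[k∸c] ⟩
  2 * (k ∸ c) * suc k ^ c    ≡⟨ xy∙z≈x∙zy 2 (k ∸ c) (suc k ^ c) ⟩
  2 * (suc k ^ c * (k ∸ c))  ≤⟨ *-monoʳ-≤ 2 ([1+k]^c*[k∸c]≤k*k^c c k) ⟩
  2 * (k * k ^ c)            ≡⟨ x∙yz≈y∙xz 2 k (k ^ c) ⟩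
  k * (2 * k ^ c)            ∎)
  where
  open ≤-Reasoning
  c+c≤k : c + c ≤ k
  c+c≤k = subst (_≤ k) (cong (c +_) (+-identityʳ c)) 2c≤k
  k≤2*[k∸c] : k ≤ 2 * (k ∸ c)
  k≤2*[k∸c] = begin
    k                    ≤⟨ m≤n+m∸n k c ⟩
    c + (k ∸ c)          ≤⟨ +-monoˡ-≤ (k ∸ c) (m+n≤o⇒m≤o∸n c c+c≤k) ⟩
    (k ∸ c) + (k ∸ c)    ≡⟨ cong (k ∸ c +_) (sym (+-identityʳ (k ∸ c))) ⟩
    2 * (k ∸ c)          ∎

[m+a]^c≤2^m*a^c : ∀ c a m → 2 * c ≤ a → (m + a) ^ c ≤ 2 ^ m * a ^ c
[m+a]^c≤2^m*a^c c a zero    _    = ≤-reflexive (sym (*-identityˡ (a ^ c)))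
[m+a]^c≤2^m*a^c c a (suc m) 2c≤a = begin
  suc (m + a) ^ c      ≤⟨ [1+k]^c≤2*k^c c (m + a) (≤-trans 2c≤a (m≤n+m a m)) ⟩
  2 * (m + a) ^ c      ≤⟨ *-monoʳ-≤ 2 ([m+a]^c≤2^m*a^c c a m 2c≤a) ⟩
  2 * (2 ^ m * a ^ c)  ≡⟨ sym (*-assoc 2 (2 ^ m) (a ^ c)) ⟩
  2 * 2 ^ m * a ^ c    ∎
  where open ≤-Reasoning

-- k^(c+1) / 2^k does not increase from a = 2(c+1) on, so
-- k · A k^c ≤ A a^(c+1) 2^(k−a), which is below k · 2^k once k > A a^(c+1).
polynomial<exponential : ∀ A c → ∃ λ k₀ → ∀ k → k₀ ≤ k → A * k ^ c < 2 ^ k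
polynomial<exponential A c = suc (A * B) + a , bound
  where
  a = 2 * suc c
  B = a ^ suc c
  bound : ∀ k → suc (A * B) + a ≤ k → A * k ^ c < 2 ^ k
  bound k k₀≤k = *-cancelˡ-< k (A * k ^ c) (2 ^ k) (begin-strict
    k * (A * k ^ c)      ≡⟨ x∙yz≈y∙xz k A (k ^ c) ⟩
    A * k ^ suc c        ≤⟨ *-monoʳ-≤ A k^[1+c]≤2^m*B ⟩
    A * (2 ^ m * B)      ≡⟨ x∙yz≈xz∙y A (2 ^ m) B ⟩
    A * B * 2 ^ m        <⟨ *-monoˡ-< (2 ^ m) {{m^n≢0 2 m}} (m+n≤o⇒m≤o (suc (A * B)) k₀≤k) ⟩
    k * 2 ^ m            ≤⟨ *-monoʳ-≤ k (^-monoʳ-≤ 2 (m∸n≤m k a)) ⟩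
    k * 2 ^ k            ∎)
    where
    open ≤-Reasoning
    m = k ∸ a
    k^[1+c]≤2^m*B : k ^ suc c ≤ 2 ^ m * B
    k^[1+c]≤2^m*B = subst (λ n → n ^ suc c ≤ 2 ^ m * B) (m∸n+n≡m (m+n≤o⇒n≤o (suc (A * B)) k₀≤k))
                      ([m+a]^c≤2^m*a^c (suc c) a m ≤-refl)

[1+2c]*x<1+2q⇒c*x<q : ∀ c x q → 0 < x → suc (2 * c) * x < suc (2 * q) → c * x < q
[1+2c]*x<1+2q⇒c*x<q c x q 0<x lt = *-cancelˡ-< 2 (c * x) q (s≤s⁻¹ (begin-strict
  suc (2 * (c * x))  ≤⟨ +-monoˡ-≤ (2 * (c * x)) 0<x ⟩
  x + 2 * (c * x)    ≡⟨ cong (x +_) (*-assoc 2 c x) ⟨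
  suc (2 * c) * x    <⟨ lt ⟩
  suc (2 * q)        ∎))
  where open ≤-Reasoning

queries-Mrk-superpolynomial :
  ∀ {r} → 1 ≤ r → ∀ c → ∃ λ k₀ → ∀ k → k₀ ≤ k → r ≤ k → (part : Fin k → Fin r) →
  (T : Tree (k + k)) → Computes (IsBasis-Mrk part) unitWeights T → c * k ^ c < queries T zeroOracle
queries-Mrk-superpolynomial 1≤r c with polynomial<exponential (suc (2 * c)) c
... | k₀ , poly<exp = k₀ , λ k k₀≤k r≤k part T computes →
  [1+2c]*x<1+2q⇒c*x<q c (k ^ c) (queries T zeroOracle)
    (m^n>0 k {{>-nonZero (≤-trans 1≤r r≤k)}} c)
    (<-≤-trans (poly<exp k k₀≤k) (2^k≤1+2*queries part T computes))

proposition2p4 : ((n : ℕ) (M : Matroid n) (T : Tree n) → Computes (Matroid.IsBasis M) unitWeights T → ∃ λ f → ∀ B → Matroid.IsBasis M B → Examines unitWeights T f B)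
    × ((r : ℕ) → 1 ≤ r → (c : ℕ) → ∃ λ k₀ → (k : ℕ) → k₀ ≤ k → r ≤ k → (part : Fin k → Fin r) → IsPartition part → (T : Tree (k Data.Nat.+ k)) → Computes (IsBasis-Mrk part) unitWeights T → ∃ λ f → c * k ^ c < queries T f)
proposition2p4 =
  (λ n M T computes → zeroOracle , examines-every-basis (Matroid.IsBasis M) unitWeights T computes) ,
  λ r 1≤r c → let k₀ , bound = queries-Mrk-superpolynomial 1≤r c in
    k₀ , λ k k₀≤k r≤k part _ T computes → zeroOracle , bound k k₀≤k r≤k part T computes
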